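{- Let $\mathcal P$ be a pure $2$-dimensional simplicial poset and let $G\subseteq\mathcal P^{(1)}$ be a bypassing subgraph in $\mathcal P$. Then the function $d_G^{\mathcal P}:\mathcal P(1)\to\mathbb Z_{>0}$ is a metric on $\mathcal P$.
   Context: A simplicial poset is a poset with unique minimum $\hat0$ in which every interval $[\hat0,x]$ is isomorphic to a Boolean lattice; elements whose lower interval is the Boolean lattice on $1,2,3$ elements are vertices, edges, triangles ($\mathcal P(0),\mathcal P(1),\mathcal P(2)$); each edge has two distinct endpoints, each triangle has three distinct vertices and three edge facets, each facet joining two of its vertices. Pure $2$-dimensional: every maximal element is a triangle. $\mathcal P^{(1)}$ is the graph (multiple edges allowed) with vertices $\mathcal P(0)$ and edges $\mathcal P(1)$. A metric on $\mathcal P$ is a function $d:\mathcal P(1)\to\mathbb R_{\ge0}$ such that for every triangle with facets $e_1,e_2,e_3$: $d(e_1)+d(e_2)\ge d(e_3)$, $d(e_2)+d(e_3)\ge d(e_1)$, $d(e_1)+d(e_3)\ge d(e_2)$. A walk is a sequence of edges $e_1,\dots,e_n$ ($n\ge1$) together with vertices $v_1,\dots,v_{n+1}$ such that $e_i$ has endpoints $v_i,v_{i+1}$; its length is $n$; it connects $v_1$ and $v_{n+1}$. If $e_i,e_{i+1}$ are consecutive edges of a walk and there is a triangle $\Delta$ whose facets are $e_i,e_{i+1},\tilde e$, then replacing $e_i,e_{i+1}$ by $\tilde e$ (and deleting $v_{i+1}$) is an elementary contraction along $\Delta$. A walk $p$ can be contracted to a walk $q$ if $q$ is obtained from $p$ by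 a finite (possibly empty) sequence of elementary contractions. A subgraph $G\subseteq\mathcal P^{(1)}$ is bypassing in $\mathcal P$ if it contains all vertices of $\mathcal P$ and for every edge $e\in\mathcal P(1)$ there is a walk all of whose edges lie in $G$ that can be contracted to the one-edge walk $e$. For such $G$, $B_G^{\mathcal P}(e)$ is the set of shortest walks in $G$ that can be contracted to $e$, and $d_G^{\mathcal P}(e)$ is their common length. -}

module Defs where

open import Data.Nat using (ℕ; zero; suc; _+_; _≤_; _<_)
open import Data.Fin using (Fin; zero; suc)
open import Data.Product using (Σ; ∃; _×_; _,_; proj₁; proj₂)
open import Data.Sum using (_⊎_)
open import Relation.Binary.PropositionalEquality using (_≡_; _≢_)
open import Relation.Binary.Construct.Closure.ReflexiveTransitive using (Star)

-- A simplicial poset of dimension ≤ 2, presented by its elements of rank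
-- 1, 2, 3 (vertices, edges, triangles) and their incidences.  The order is
-- recovered from the incidences; every lower interval is Boolean exactly
-- because of the distinctness conditions below.  Multiple edges / triangles
-- with the same vertex set are allowed.
record SimplicialPoset2 : Set₁ where
  field
    V E T : Set
    ends          : E → V × V
    ends-distinct : ∀ e → proj₁ (ends e) ≢ proj₂ (ends e)
    vert          : T → Fin 3 → V
    vert-inj      : ∀ t i j → vert t i ≡ vert t j → i ≡ j
    facet         : T → Fin 3 → E

  Joins : E → V → V → Set
  Joins e a b = (ends e ≡ (a , b)) ⊎ (ends e ≡ (b , a))

  field
    facet0 : ∀ t → Joins (facet t zero)       (vert t (suc zero)) (vert t (suc (suc zero)))
    facet1 : ∀ t → Joins (facet t (suc zero)) (vert t zero)       (vert t (suc (suc zero)))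
    facet2 : ∀ t → Joins (facet t (suc (suc zero))) (vert t zero) (vert t (suc zero))

module _ (P : SimplicialPoset2) where
  open SimplicialPoset2 P

  -- pure 2-dimensional: every maximal element is a triangle, i.e. every
  -- vertex lies on an edge and every edge is a facet of a triangle
  -- (hence the complex has dimension exactly 2 when nonempty)
  IsPure2 : Set
  IsPure2 = (∀ v → ∃ λ e → (proj₁ (ends e) ≡ v) ⊎ (proj₂ (ends e) ≡ v))
          × (∀ e → ∃ λ t → ∃ λ (i : Fin 3) → facet t i ≡ e)

  FacetsOf : T → E → E → E → Set
  FacetsOf t e e' e'' =
    ∃ λ (i : Fin 3) → ∃ λ (j : Fin 3) → ∃ λ (k : Fin 3) →
      (i ≢ j) × (j ≢ k) × (i ≢ k) ×
      (facet t i ≡ e) × (facet t j ≡ e') × (facet t k ≡ e'')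

  data Walk : V → V → Set where
    edge : ∀ {a b} (e : E) → Joins e a b → Walk a b
    cons : ∀ {a b c} (e : E) → Joins e a b → Walk b c → Walk a c

  length : ∀ {a b} → Walk a b → ℕ
  length (edge e _)   = 1
  length (cons e _ w) = suc (length w)

  -- all edges of the walk lie in the subgraph G (G ⊆ P^(1) contains all
  -- vertices, so it is given by its edge set)
  InG : (E → Set) → ∀ {a b} → Walk a b → Set
  InG G (edge e _)   = G e
  InG G (cons e _ w) = G e × InG G w

  data Contract1 : ∀ {a b} → Walk a b → Walk a b → Set where
    last : ∀ {a b c} {e e' ẽ : E} (j : Joins e a b) (j' : Joins e' b c)
             (j̃ : Joins ẽ a c) (t : T) → FacetsOf t e e' ẽ →
             Contract1 (cons e j (edge e' j')) (edge ẽ j̃)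
    here : ∀ {a b c d} {e e' ẽ : E} (j : Joins e a b) (j' : Joins e' b c)
             (j̃ : Joins ẽ a c) (w : Walk c d) (t : T) → FacetsOf t e e' ẽ →
             Contract1 (cons e j (cons e' j' w)) (cons ẽ j̃ w)
    there : ∀ {a b c} {e : E} (j : Joins e a b) {w w' : Walk b c} →
             Contract1 w w' → Contract1 (cons e j w) (cons e j w')

  ContractsTo : ∀ {a b} → Walk a b → Walk a b → Set
  ContractsTo = Star Contract1

  ContractsToEdge : ∀ {a b} → Walk a b → E → Set
  ContractsToEdge {a} {b} p e = Σ (Joins e a b) λ j → ContractsTo p (edge e j)

  IsBypassing : (E → Set) → Set
  IsBypassing G = ∀ e → ∃ λ a → ∃ λ b → Σ (Walk a b) λ p →
                    InG G p × ContractsToEdge p e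

  IsDist : (E → Set) → E → ℕ → Set
  IsDist G e n =
    (∃ λ a → ∃ λ b → Σ (Walk a b) λ p → InG G p × ContractsToEdge p e × length p ≡ n)
    × (∀ {a b} (p : Walk a b) → InG G p → ContractsToEdge p e → n ≤ length p)

  IsMetric : (E → ℕ) → Set
  IsMetric d = ∀ t →
      (d (facet t f2) ≤ d (facet t f0) + d (facet t f1))
    × (d (facet t f0) ≤ d (facet t f1) + d (facet t f2))
    × (d (facet t f1) ≤ d (facet t f0) + d (facet t f2))
    where
      f0 f1 f2 : Fin 3
      f0 = zero
      f1 = suc zero
      f2 = suc (suc zero)

{-# OPTIONS --safe #-}
-- Shortest bypassing walks for two facets of a triangle, oriented so that they
-- meet at the common vertex, concatenate to a walk in G that contracts first to
-- the two-edge walk along these facets and then, along the triangle, to the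
-- third facet.  Hence the third distance is at most the sum of the other two.
-- Positivity holds because every walk has at least one edge.
module Submission where

open import Defs
open import Data.Nat using (ℕ; _<_; _≤_; _+_; suc; s≤s; z≤n)
open import Data.Nat.Properties using (+-comm)
open import Data.Product using (_×_; _,_; proj₁; proj₂; Σ)
open import Data.Sum using (_⊎_; inj₁; inj₂)
open import Relation.Binary.PropositionalEquality
open import Relation.Binary.Construct.Closure.ReflexiveTransitive using (ε; _◅_; _◅◅_; gmap)

module _ (P : SimplicialPoset2) where
  open SimplicialPoset2 P

  Joins-sym : ∀ {e a b} → Joins e a b → Joins e b a
  Joins-sym (inj₁ eq) = inj₂ eq
  Joins-sym (inj₂ eq) = inj₁ eq

  Joins-unique : ∀ {e a b x y} → Joins e a b → Joins e x y →
                 (a ≡ x × b ≡ y) ⊎ (a ≡ y × b ≡ x)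
  Joins-unique (inj₁ p) (inj₁ q) = let r = trans (sym p) q in inj₁ (cong proj₁ r , cong proj₂ r)
  Joins-unique (inj₁ p) (inj₂ q) = let r = trans (sym p) q in inj₂ (cong proj₁ r , cong proj₂ r)
  Joins-unique (inj₂ p) (inj₁ q) = let r = trans (sym p) q in inj₂ (cong proj₂ r , cong proj₁ r)
  Joins-unique (inj₂ p) (inj₂ q) = let r = trans (sym p) q in inj₁ (cong proj₂ r , cong proj₁ r)

  FacetsOf-swap : ∀ {t e e' e''} → FacetsOf P t e e' e'' → FacetsOf P t e' e e''
  FacetsOf-swap (i , j , k , i≢j , j≢k , i≢k , fi , fj , fk) =
    j , i , k , (λ j≡i → i≢j (sym j≡i)) , i≢k , j≢k , fj , fi , fk

  length-positive : ∀ {a b} (w : Walk P a b) → 0 < length P w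
  length-positive (edge _ _)   = s≤s z≤n
  length-positive (cons _ _ _) = s≤s z≤n

  infixr 5 _++_

  _++_ : ∀ {a b c} → Walk P a b → Walk P b c → Walk P a c
  edge e j   ++ u = cons e j u
  cons e j w ++ u = cons e j (w ++ u)

  ++-assoc : ∀ {a b c d} (w : Walk P a b) (u : Walk P b c) (v : Walk P c d) →
             (w ++ u) ++ v ≡ w ++ (u ++ v)
  ++-assoc (edge e j)   u v = refl
  ++-assoc (cons e j w) u v = cong (cons e j) (++-assoc w u v)

  reverse : ∀ {a b} → Walk P a b → Walk P b a
  reverse (edge e j)   = edge e (Joins-sym j)
  reverse (cons e j w) = reverse w ++ edge e (Joins-sym j)

  length-++ : ∀ {a b c} (w : Walk P a b) (u : Walk P b c) →
              length P (w ++ u) ≡ length P w + length P u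
  length-++ (edge e j)   u = refl
  length-++ (cons e j w) u = cong suc (length-++ w u)

  length-reverse : ∀ {a b} (w : Walk P a b) → length P (reverse w) ≡ length P w
  length-reverse (edge e j)   = refl
  length-reverse (cons e j w) = begin
    length P (reverse w ++ edge e (Joins-sym j))  ≡⟨ length-++ (reverse w) _ ⟩
    length P (reverse w) + 1                       ≡⟨ cong (_+ 1) (length-reverse w) ⟩
    length P w + 1                                 ≡⟨ +-comm (length P w) 1 ⟩
    suc (length P w)                               ∎
    where open ≡-Reasoning

  Contract1-++⁺ˡ : ∀ {a b c} {w w' : Walk P a b} (u : Walk P b c) →
                   Contract1 P w w' → Contract1 P (w ++ u) (w' ++ u)
  Contract1-++⁺ˡ u (last j j' j̃ t F)   = here j j' j̃ u t F
  Contract1-++⁺ˡ u (here j j' j̃ w t F) = here j j' j̃ (w ++ u) t F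
  Contract1-++⁺ˡ u (there j c)         = there j (Contract1-++⁺ˡ u c)

  Contract1-++⁺ʳ : ∀ {a b c} (w : Walk P a b) {u u' : Walk P b c} →
                   Contract1 P u u' → Contract1 P (w ++ u) (w ++ u')
  Contract1-++⁺ʳ (edge e j)   c = there j c
  Contract1-++⁺ʳ (cons e j w) c = there j (Contract1-++⁺ʳ w c)

  Contract1-reverse⁺ : ∀ {a b} {w w' : Walk P a b} →
                       Contract1 P w w' → Contract1 P (reverse w) (reverse w')
  Contract1-reverse⁺ (last j j' j̃ t F) =
    last (Joins-sym j') (Joins-sym j) (Joins-sym j̃) t (FacetsOf-swap F)
  Contract1-reverse⁺ (here {e = e} {e' = e'} j j' j̃ w t F) =
    subst (λ v → Contract1 P v (reverse w ++ edge _ (Joins-sym j̃)))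
      (sym (++-assoc (reverse w) (edge e' (Joins-sym j')) (edge e (Joins-sym j))))
      (Contract1-++⁺ʳ (reverse w)
        (last (Joins-sym j') (Joins-sym j) (Joins-sym j̃) t (FacetsOf-swap F)))
  Contract1-reverse⁺ (there {e = e} j c) =
    Contract1-++⁺ˡ (edge e (Joins-sym j)) (Contract1-reverse⁺ c)

  ContractsTo-++⁺ˡ : ∀ {a b c} {w w' : Walk P a b} (u : Walk P b c) →
                     ContractsTo P w w' → ContractsTo P (w ++ u) (w' ++ u)
  ContractsTo-++⁺ˡ u = gmap (_++ u) (Contract1-++⁺ˡ u)

  ContractsTo-++⁺ʳ : ∀ {a b c} (w : Walk P a b) {u u' : Walk P b c} →
                     ContractsTo P u u' → ContractsTo P (w ++ u) (w ++ u')
  ContractsTo-++⁺ʳ w = gmap (w ++_) (Contract1-++⁺ʳ w)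

  ContractsTo-reverse⁺ : ∀ {a b} {w w' : Walk P a b} →
                         ContractsTo P w w' → ContractsTo P (reverse w) (reverse w')
  ContractsTo-reverse⁺ = gmap reverse Contract1-reverse⁺

  module _ (G : E → Set) where

    InG-++⁺ : ∀ {a b c} (w : Walk P a b) (u : Walk P b c) →
              InG P G w → InG P G u → InG P G (w ++ u)
    InG-++⁺ (edge e j)   u g         h = g , h
    InG-++⁺ (cons e j w) u (g , gw) h = g , InG-++⁺ w u gw h

    InG-reverse⁺ : ∀ {a b} (w : Walk P a b) → InG P G w → InG P G (reverse w)
    InG-reverse⁺ (edge e j)   g        = g
    InG-reverse⁺ (cons e j w) (g , gw) = InG-++⁺ (reverse w) (edge e _) (InG-reverse⁺ w gw) g

    -- The existence half of IsDist G e n is exactly ∃ λ a → ∃ λ b → Bypass e a b n.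
    Bypass : E → V → V → ℕ → Set
    Bypass e x y n = Σ (Walk P x y) λ p → InG P G p × ContractsToEdge P p e × length P p ≡ n

    Bypass-reverse : ∀ {e x y n} → Bypass e x y n → Bypass e y x n
    Bypass-reverse (p , g , (j , c) , len) =
      reverse p , InG-reverse⁺ p g , (Joins-sym j , ContractsTo-reverse⁺ c) ,
      trans (length-reverse p) len

    Bypass-reorient : ∀ {e a b x y n} → Bypass e a b n → Joins e x y → Bypass e x y n
    Bypass-reorient bp@(_ , _ , (j , _) , _) j' with Joins-unique j j'
    ... | inj₁ (refl , refl) = bp
    ... | inj₂ (refl , refl) = Bypass-reverse bp

    Bypass-++ : ∀ {t e₁ e₂ e₃ x y z m n} → Bypass e₁ x y m → Bypass e₂ y z n →
                Joins e₃ x z → FacetsOf P t e₁ e₂ e₃ → Bypass e₃ x z (m + n)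
    Bypass-++ {t} (p₁ , g₁ , (j₁ , c₁) , len₁) (p₂ , g₂ , (j₂ , c₂) , len₂) j₃ F =
      p₁ ++ p₂ , InG-++⁺ p₁ p₂ g₁ g₂ ,
      (j₃ , ContractsTo-++⁺ˡ p₂ c₁ ◅◅ ContractsTo-++⁺ʳ (edge _ j₁) c₂ ◅◅ last j₁ j₂ j₃ t F ◅ ε) ,
      trans (length-++ p₁ p₂) (cong₂ _+_ len₁ len₂)

    IsDist-positive : ∀ {e n} → IsDist P G e n → 0 < n
    IsDist-positive ((_ , _ , p , _ , _ , len) , _) = subst (0 <_) len (length-positive p)

    IsDist-triangle : ∀ {t e₁ e₂ e₃ x y z m n k} →
                      IsDist P G e₁ m → IsDist P G e₂ n → IsDist P G e₃ k →
                      Joins e₁ x y → Joins e₂ y z → Joins e₃ x z →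
                      FacetsOf P t e₁ e₂ e₃ → k ≤ m + n
    IsDist-triangle ((_ , _ , bp₁) , _) ((_ , _ , bp₂) , _) (_ , shortest) j₁ j₂ j₃ F
      with Bypass-++ (Bypass-reorient bp₁ j₁) (Bypass-reorient bp₂ j₂) j₃ F
    ... | p , g , c , len = subst (_ ≤_) len (shortest p g c)

    IsDist-metric : (d : E → ℕ) → (∀ e → IsDist P G e (d e)) → IsMetric P d
    IsDist-metric d isDist t =
        triangle (λ ()) (λ ()) (λ ()) (facet0 t) (Joins-sym (facet1 t)) (Joins-sym (facet2 t))
      , triangle (λ ()) (λ ()) (λ ()) (Joins-sym (facet1 t)) (facet2 t) (Joins-sym (facet0 t))
      , triangle (λ ()) (λ ()) (λ ()) (Joins-sym (facet0 t)) (Joins-sym (facet2 t)) (Joins-sym (facet1 t))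
      where
      triangle : ∀ {i j k x y z} → i ≢ j → j ≢ k → i ≢ k →
                 Joins (facet t i) x y → Joins (facet t j) y z → Joins (facet t k) x z →
                 d (facet t k) ≤ d (facet t i) + d (facet t j)
      triangle i≢j j≢k i≢k j₁ j₂ j₃ =
        IsDist-triangle (isDist _) (isDist _) (isDist _) j₁ j₂ j₃
          (_ , _ , _ , i≢j , j≢k , i≢k , refl , refl , refl)

-- Purity and bypassing are what make d_G^P well defined.
lemma4p4 : (P : SimplicialPoset2) → IsPure2 P →
    (G : SimplicialPoset2.E P → Set) → IsBypassing P G →
    (d : SimplicialPoset2.E P → ℕ) → (∀ e → IsDist P G e (d e)) →
    (∀ e → 0 < d e) × IsMetric P d
lemma4p4 P _ G _ d isDist = (λ e → IsDist-positive P G (isDist e)) , IsDist-metric P G d isDist
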